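{- $\mathsf{COH}\le_\mathrm{sW}\mathsf{wRSg}$.
   Context: Problems are multi-valued partial functions $\subseteq\omega^\omega\rightrightarrows\omega^\omega$ with standard codings. $\mathcal{F}\le_\mathrm{sW}\mathcal{G}$ if there are Turing functionals $\Phi,\Psi$ with $\Phi(f)\in\mathrm{dom}(\mathcal{G})$ for all $f\in\mathrm{dom}(\mathcal{F})$ and $\Psi(g)\in\mathcal{F}(f)$ for all $f\in\mathrm{dom}(\mathcal F)$, $g\in\mathcal{G}(\Phi(f))$. $\mathsf{COH}$: input a sequence $(A_i:i\in\omega)$ of subsets of $\omega$; output an infinite $C\subseteq\omega$ such that for each $i$, $C\setminus A_i$ is finite or $C\cap A_i$ is finite. Graphs $G=(V,E)$ are simple with $V\subseteq\omega$ infinite, $E\subseteq[V]^2$; $N(v)=\{y:(v,y)\in E\}$. $\mathsf{wRSg}$: input an infinite graph $G=(V,E)$; output an infinite $H\subseteq V$ with, for all $v\in H$, $|H\cap N(v)|=\omega$ or $|H\cap N(v)|\le1$. -}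

module Defs where

open import Level using (0ℓ)
open import Data.Nat using (ℕ; zero; suc; _+_; _*_; _≤_; _<_)
open import Data.Maybe using (Maybe; just; nothing)
open import Data.Product using (Σ; _×_; _,_)
open import Data.Sum using (_⊎_)
open import Relation.Nullary using (¬_)
open import Relation.Binary.PropositionalEquality using (_≡_)
open import Axiom.ExcludedMiddle using (ExcludedMiddle)

Baire : Set
Baire = ℕ → ℕ

tri : ℕ → ℕ
tri zero    = 0
tri (suc k) = suc k + tri k

pair : ℕ → ℕ → ℕ
pair i n = tri (i + n) + n

Infinite : (ℕ → Set) → Set
Infinite P = ∀ n → Σ ℕ λ m → n ≤ m × P m

Finite : (ℕ → Set) → Set
Finite P = Σ ℕ λ b → ∀ m → P m → m < b

AtMostOne : (ℕ → Set) → Set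
AtMostOne P = ∀ x y → P x → P y → x ≡ y

IsChar : Baire → Set
IsChar f = ∀ n → f n ≤ 1

-- Turing functionals (partial, given by an Agda-definable stage function)
-- Φ f n s = just k  means: on oracle f and input n, the computation has
-- halted by stage s with output k.  Φ(f)(n) is the output at the least
-- halting stage.

Functional : Set
Functional = Baire → ℕ → ℕ → Maybe ℕ

_⟦_⟧≡_ : Functional → Baire → Baire → Set
Φ ⟦ f ⟧≡ h = ∀ n → Σ ℕ λ s → Φ f n s ≡ just (h n) × (∀ t → t < s → Φ f n t ≡ nothing)

record Problem : Set₁ where
  field
    Dom : Baire → Set
    Sol : Baire → Baire → Set   -- Sol f g : g ∈ F(f)
open Problem public

-- strong Weihrauch reducibility.  The reduction functionals are fixed
-- first (computably); the verification is carried out in classical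
-- mathematics, i.e. under the law of excluded middle.
_≤sW_ : Problem → Problem → Set₁
F ≤sW G = Σ Functional λ Φ → Σ Functional λ Ψ →
  (ExcludedMiddle 0ℓ →
    ∀ f → Dom F f →
      Σ Baire λ f' → Φ ⟦ f ⟧≡ f' × Dom G f' ×
        (∀ g → Sol G f' g → Σ Baire λ h → Ψ ⟦ g ⟧≡ h × Sol F f h))

-- COH
-- input code f : n ∈ A_i  iff  f ⟨ i , n ⟩ ≡ 1

COH : Problem
Dom COH f = IsChar f
Sol COH f c =
  IsChar c × Infinite (λ n → c n ≡ 1) ×
  (∀ i → Finite (λ n → c n ≡ 1 × ¬ (f (pair i n) ≡ 1))
       ⊎ Finite (λ n → c n ≡ 1 × f (pair i n) ≡ 1))

Vert : Baire → ℕ → Set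
Vert g v = g (2 * v) ≡ 1

Edge : Baire → ℕ → ℕ → Set
Edge g x y = g (suc (2 * pair x y)) ≡ 1

IsGraph : Baire → Set
IsGraph g =
  IsChar g × Infinite (Vert g) ×
  (∀ x y → Edge g x y → Edge g y x) ×
  (∀ x → ¬ Edge g x x) ×
  (∀ x y → Edge g x y → Vert g x × Vert g y)

wRSg : Problem
Dom wRSg g = IsGraph g
Sol wRSg g h =
  IsChar h × (∀ v → h v ≡ 1 → Vert g v) × Infinite (λ v → h v ≡ 1) ×
  (∀ v → h v ≡ 1 →
     Infinite (λ y → h y ≡ 1 × Edge g v y)
     ⊎ AtMostOne (λ y → h y ≡ 1 × Edge g v y))

{-# OPTIONS --safe #-}
-- The element n ∈ ω is represented by the vertex ⟨n, a⟩ whose numerator a spells the bits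
-- [n ∈ A₀] … [n ∈ A_{n-1}] in binary, so that a / 2ⁿ is a dyadic rational whose i-th binary
-- digit is membership in Aᵢ. Vertices are ordered by ≺ (by that value, ties broken by index),
-- and x < y are adjacent iff x ≺ y.
--
-- Let H be a solution. Call p ∈ H a pattern if for some q ∈ H the set H ∩ [q, p) has at least
-- two elements, all ≺ p. A pattern has two, hence infinitely many, neighbours in H, so a later
-- element of H lies ≺-above it; therefore the ≺-records of H from a pattern on form an infinite
-- ≺-increasing set. If there is no pattern, infinitely many elements of H have no later
-- ≺-larger element in H (climbing twice from any point would produce a pattern), and each of
-- them has at most one earlier ≺-smaller element of H. In either case the digits of the selected
-- vertices settle one position at a time, because once the first i digits agree, a vertex with
-- digit i equal to 1 lies ≺-above one with digit i equal to 0. So the represented n form a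
-- cohesive set, and the selection is computable from H alone: stage v only needs to know the
-- least pattern p ≤ v, if any.
module Submission where

open import Defs

open import Level using (0ℓ)
open import Axiom.ExcludedMiddle using (ExcludedMiddle)
open import Data.Nat
open import Data.Nat.Properties
open import Data.Nat.DivMod
open import Data.Nat.Divisibility using (n∣m*n; divides)
open import Data.Nat.Induction using (<-rec)
open import Data.Bool using (Bool; true; false)
open import Data.Product using (∃; ∃₂; _×_; _,_; proj₁; proj₂; uncurry)
open import Data.Sum using (_⊎_; inj₁; inj₂; swap)
open import Data.Empty using (⊥; ⊥-elim)
open import Data.Maybe using (just)
open import Function using (_∘_)
open import Relation.Nullary
open import Relation.Nullary.Decidable using (map′; _×-dec_; _⊎-dec_; _→-dec_; ¬?)
open import Relation.Unary using (Decidable)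
open import Relation.Binary.PropositionalEquality
open import Relation.Binary.Definitions using (tri<; tri≈; tri>)
open import Relation.Binary.Core using (_Preserves_⟶_; _Preserves₂_⟶_⟶_)
open import Algebra.Properties.CommutativeSemigroup *-commutativeSemigroup
  using (xy∙z≈xz∙y; x∙yz≈y∙xz)

indicator : {P : Set} → Dec P → ℕ
indicator (yes _) = 1
indicator (no _)  = 0

indicator≤1 : {P : Set} (d : Dec P) → indicator d ≤ 1
indicator≤1 (yes _) = ≤-refl
indicator≤1 (no _)  = z≤n

indicator-sound : {P : Set} (d : Dec P) → indicator d ≡ 1 → P
indicator-sound (yes p) _ = p

indicator-complete : {P : Set} (d : Dec P) → P → indicator d ≡ 1
indicator-complete (yes _) _  = refl
indicator-complete (no ¬p) p = ⊥-elim (¬p p)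

Least : (ℕ → Set) → ℕ → Set
Least P k = P k × (∀ {j} → j < k → ¬ P j)

minimal : {P : ℕ → Set} → Decidable P → ∀ m → P m → ∃ (Least P)
minimal {P} P? = <-rec (λ m → P m → ∃ (Least P)) search
  where
  search : ∀ m → (∀ {k} → k < m → P k → ∃ (Least P)) → P m → ∃ (Least P)
  search m smaller pm with anyUpTo? P? m
  ... | yes (k , k<m , pk) = smaller k<m pk
  ... | no none            = m , pm , λ j<m pj → none (_ , j<m , pj)

Least-unique : ∀ {P : ℕ → Set} {m n} → Least P m → Least P n → m ≡ n
Least-unique {m = m} {n} (pm , below-m) (pn , below-n) with <-cmp m n
... | tri< m<n _ _ = ⊥-elim (below-n m<n pm)
... | tri≈ _ m≡n _ = m≡n
... | tri> _ _ n<m = ⊥-elim (below-m n<m pn)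

unpair-step : ℕ × ℕ → ℕ × ℕ
unpair-step (zero  , n) = suc n , 0
unpair-step (suc i , n) = i , suc n

unpair : ℕ → ℕ × ℕ
unpair zero    = 0 , 0
unpair (suc m) = unpair-step (unpair m)

pair-suc : ∀ i n → pair i (suc n) ≡ suc (pair (suc i) n)
pair-suc i n = begin
  tri (i + suc n) + suc n   ≡⟨ cong (λ k → tri k + suc n) (+-suc i n) ⟩
  tri (suc i + n) + suc n   ≡⟨ +-suc (tri (suc i + n)) n ⟩
  suc (tri (suc i + n) + n) ∎
  where open ≡-Reasoning

pair-next-diagonal : ∀ k → pair (suc k) 0 ≡ suc (pair 0 k)
pair-next-diagonal k = begin
  tri (suc k + 0) + 0 ≡⟨ +-identityʳ _ ⟩
  tri (suc k + 0)     ≡⟨ cong tri (+-identityʳ (suc k)) ⟩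
  suc k + tri k       ≡⟨ cong suc (+-comm k (tri k)) ⟩
  suc (tri k + k)     ∎
  where open ≡-Reasoning

unpair-pair : ∀ i n → unpair (pair i n) ≡ (i , n)
unpair-pair i n = along-diagonal (i + n) i n refl
  where
  along-diagonal : ∀ d i n → i + n ≡ d → unpair (pair i n) ≡ (i , n)
  along-diagonal d i (suc n) i+n≡d =
    trans (cong unpair (pair-suc i n))
          (cong unpair-step (along-diagonal d (suc i) n (trans (sym (+-suc i n)) i+n≡d)))
  along-diagonal d zero zero _ = refl
  along-diagonal (suc d) (suc k) zero k+0≡d =
    trans (cong unpair (pair-next-diagonal k))
          (cong unpair-step (along-diagonal d 0 k (suc-injective (trans (sym (+-identityʳ (suc k))) k+0≡d))))

pair-unpair : ∀ m → uncurry pair (unpair m) ≡ m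
pair-unpair zero = refl
pair-unpair (suc m) with unpair m | pair-unpair m
... | zero  , n | eq = trans (pair-next-diagonal n) (cong suc eq)
... | suc i , n | eq = trans (pair-suc i n) (cong suc eq)

tri-mono-≤ : tri Preserves _≤_ ⟶ _≤_
tri-mono-≤ {zero}          _         = z≤n
tri-mono-≤ {suc j} {suc k} (s≤s j≤k) = +-mono-≤ (s≤s j≤k) (tri-mono-≤ j≤k)

pair-mono-≤ : pair Preserves₂ _≤_ ⟶ _≤_ ⟶ _≤_
pair-mono-≤ i≤j m≤n = +-mono-≤ (tri-mono-≤ (+-mono-≤ i≤j m≤n)) m≤n

n≤tri[n] : ∀ n → n ≤ tri n
n≤tri[n] zero    = z≤n
n≤tri[n] (suc n) = m≤m+n (suc n) (tri n)

m≤pair[m,n] : ∀ m n → m ≤ pair m n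
m≤pair[m,n] m n = ≤-trans (≤-trans (m≤m+n m n) (n≤tri[n] (m + n))) (m≤m+n _ n)

cross-≤-trans : ∀ {a b c A B C} .{{_ : NonZero B}} → a * B ≤ b * A → b * C ≤ c * B → a * C ≤ c * A
cross-≤-trans {a} {b} {c} {A} {B} {C} ab bc = *-cancelʳ-≤ (a * C) (c * A) B (begin
  a * C * B ≡⟨ xy∙z≈xz∙y a C B ⟩
  a * B * C ≤⟨ *-monoˡ-≤ C ab ⟩
  b * A * C ≡⟨ xy∙z≈xz∙y b A C ⟩
  b * C * A ≤⟨ *-monoˡ-≤ A bc ⟩
  c * B * A ≡⟨ xy∙z≈xz∙y c B A ⟩
  c * A * B ∎)
  where open ≤-Reasoning

cross-floor-mono : ∀ {a b A B} k .{{_ : NonZero A}} .{{_ : NonZero B}} →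
                   a * B ≤ b * A → a * k / A ≤ b * k / B
cross-floor-mono {a} {b} {A} {B} k ab = begin
  q         ≡⟨ m*n/n≡m q B ⟨
  q * B / B ≤⟨ /-monoˡ-≤ B qB≤bk ⟩
  b * k / B ∎
  where
  open ≤-Reasoning
  q : ℕ
  q = a * k / A
  qB≤bk : q * B ≤ b * k
  qB≤bk = *-cancelʳ-≤ (q * B) (b * k) A (begin
    q * B * A ≡⟨ xy∙z≈xz∙y q B A ⟩
    q * A * B ≤⟨ *-monoˡ-≤ B (m/n*n≤m (a * k) A) ⟩
    a * k * B ≡⟨ xy∙z≈xz∙y a k B ⟩
    a * B * k ≤⟨ *-monoˡ-≤ k ab ⟩
    b * A * k ≡⟨ xy∙z≈xz∙y b A k ⟩
    b * k * A ∎)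

double-/ : ∀ m D .{{_ : NonZero D}} → 2 * m / D ≡ 2 * (m / D) + 2 * (m % D) / D
double-/ m D = begin
  2 * m / D                             ≡⟨ /-congˡ (cong (2 *_) (m≡m%n+[m/n]*n m D)) ⟩
  2 * (m % D + m / D * D) / D           ≡⟨ /-congˡ (*-distribˡ-+ 2 (m % D) (m / D * D)) ⟩
  (2 * (m % D) + 2 * (m / D * D)) / D   ≡⟨ /-congˡ (cong (2 * (m % D) +_) (*-assoc 2 (m / D) D)) ⟨
  (2 * (m % D) + 2 * (m / D) * D) / D   ≡⟨ +-distrib-/-∣ʳ (2 * (m % D)) (n∣m*n (2 * (m / D))) ⟩
  2 * (m % D) / D + 2 * (m / D) * D / D ≡⟨ cong (2 * (m % D) / D +_) (m*n/n≡m (2 * (m / D)) D) ⟩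
  2 * (m % D) / D + 2 * (m / D)         ≡⟨ +-comm _ (2 * (m / D)) ⟩
  2 * (m / D) + 2 * (m % D) / D         ∎
  where open ≡-Reasoning

double-%-/≤1 : ∀ m D .{{_ : NonZero D}} → 2 * (m % D) / D ≤ 1
double-%-/≤1 m D = ≤-pred (m<n*o⇒m/o<n (*-monoʳ-< 2 (m%n<n m D)))

[2*c+b]/2≡c : ∀ c {b} → b ≤ 1 → (2 * c + b) / 2 ≡ c
[2*c+b]/2≡c c {b} b≤1 = begin
  (2 * c + b) / 2   ≡⟨ +-distrib-/-∣ˡ b (divides c (*-comm 2 c)) ⟩
  2 * c / 2 + b / 2 ≡⟨ cong₂ _+_ (/-congˡ (*-comm 2 c)) (m<n⇒m/n≡0 (s≤s b≤1)) ⟩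
  c * 2 / 2 + 0     ≡⟨ +-identityʳ _ ⟩
  c * 2 / 2         ≡⟨ m*n/n≡m c 2 ⟩
  c                 ∎
  where open ≡-Reasoning

infixl 7 _/2^_ _%2^_

_/2^_ : ℕ → ℕ → ℕ
m /2^ n = _/_ m (2 ^ n) {{m^n≢0 2 n}}

_%2^_ : ℕ → ℕ → ℕ
m %2^ n = _%_ m (2 ^ n) {{m^n≢0 2 n}}

-- Binary codes of membership

typeCode : Baire → ℕ → ℕ → ℕ
typeCode f n zero    = 0
typeCode f n (suc k) = 2 * typeCode f n k + f (pair k n)

module _ {f : Baire} (f-char : IsChar f) (n : ℕ) where

  typeCode<2^ : ∀ k → typeCode f n k < 2 ^ k
  typeCode<2^ zero    = s≤s z≤n
  typeCode<2^ (suc k) = begin-strict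
    2 * c + f (pair k n) ≤⟨ +-monoʳ-≤ (2 * c) (f-char (pair k n)) ⟩
    2 * c + 1            ≡⟨ +-comm (2 * c) 1 ⟩
    suc (2 * c)          <⟨ ≤-reflexive (sym (*-suc 2 c)) ⟩
    2 * suc c            ≤⟨ *-monoʳ-≤ 2 (typeCode<2^ k) ⟩
    2 * 2 ^ k            ∎
    where
    open ≤-Reasoning
    c : ℕ
    c = typeCode f n k

  typeCode-truncate : ∀ d j → typeCode f n (d + j) /2^ d ≡ typeCode f n j
  typeCode-truncate zero    j = n/1≡n (typeCode f n j)
  typeCode-truncate (suc d) j = begin
    (2 * c + b) / (2 * 2 ^ d) ≡⟨ m/n/o≡m/[n*o] (2 * c + b) 2 (2 ^ d) ⟨
    (2 * c + b) / 2 / 2 ^ d   ≡⟨ /-congˡ ([2*c+b]/2≡c c (f-char (pair (d + j) n))) ⟩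
    c / 2 ^ d                 ≡⟨ typeCode-truncate d j ⟩
    typeCode f n j            ∎
    where
    open ≡-Reasoning
    instance
      _ = m^n≢0 2 d
      _ = m^n≢0 2 (suc d)
    c b : ℕ
    c = typeCode f n (d + j)
    b = f (pair (d + j) n)

  typeCode-prefix : ∀ d j → typeCode f n (d + j) * 2 ^ j /2^ (d + j) ≡ typeCode f n j
  typeCode-prefix d j = begin
    c * 2 ^ j / 2 ^ (d + j)     ≡⟨ /-congʳ (^-distribˡ-+-* 2 d j) ⟩
    c * 2 ^ j / (2 ^ d * 2 ^ j) ≡⟨ m*n/o*n≡m/o c (2 ^ j) (2 ^ d) ⟩
    c / 2 ^ d                   ≡⟨ typeCode-truncate d j ⟩
    typeCode f n j              ∎
    where
    open ≡-Reasoning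
    instance
      _ = m^n≢0 2 d
      _ = m^n≢0 2 (d + j)
      _ = m*n≢0 (2 ^ d) (2 ^ j) {{m^n≢0 2 d}} {{m^n≢0 2 j}}
    c : ℕ
    c = typeCode f n (d + j)

-- Vertices and their dyadic values

elt num : ℕ → ℕ
elt v = proj₁ (unpair v)
num v = proj₂ (unpair v)

record IsVertex (f : Baire) (v : ℕ) : Set where
  constructor isVertex
  field num≡typeCode : num v ≡ typeCode f (elt v) (elt v)

isVertex? : ∀ f v → Dec (IsVertex f v)
isVertex? f v = map′ isVertex IsVertex.num≡typeCode (num v ≟ typeCode f (elt v) (elt v))

infix 4 _≼_ _≺_ _≼?_ _≺?_

_≼_ : ℕ → ℕ → Set
u ≼ w = num u * 2 ^ elt w ≤ num w * 2 ^ elt u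

_≺_ : ℕ → ℕ → Set
u ≺ w = u ≼ w × (w ≼ u → u < w)

_≼?_ : ∀ u w → Dec (u ≼ w)
u ≼? w = num u * 2 ^ elt w ≤? num w * 2 ^ elt u

_≺?_ : ∀ u w → Dec (u ≺ w)
u ≺? w = (u ≼? w) ×-dec ((w ≼? u) →-dec (u <? w))

≼-trans : ∀ {u v w} → u ≼ v → v ≼ w → u ≼ w
≼-trans {u} {v} {w} =
  cross-≤-trans {num u} {num v} {num w} {2 ^ elt u} {2 ^ elt v} {2 ^ elt w} {{m^n≢0 2 (elt v)}}

≼-total : ∀ u w → u ≼ w ⊎ w ≼ u
≼-total u w = ≤-total (num u * 2 ^ elt w) (num w * 2 ^ elt u)

⋡⇒≺ : ∀ {u w} → ¬ w ≼ u → u ≺ w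
⋡⇒≺ {u} {w} w⋠u with ≼-total u w
... | inj₁ u≼w = u≼w , λ w≼u → ⊥-elim (w⋠u w≼u)
... | inj₂ w≼u = ⊥-elim (w⋠u w≼u)

≺-trans : ∀ {u v w} → u ≺ v → v ≺ w → u ≺ w
≺-trans {u} {v} {w} (u≼v , v≼u⇒u<v) (v≼w , w≼v⇒v<w) =
  ≼-trans {u} {v} {w} u≼v v≼w ,
  λ w≼u → <-trans (v≼u⇒u<v (≼-trans {v} {w} {u} v≼w w≼u))
                  (w≼v⇒v<w (≼-trans {w} {u} {v} w≼u u≼v))

≺-asym : ∀ {u w} → u ≺ w → ¬ w ≺ u
≺-asym (u≼w , w≼u⇒u<w) (w≼u , u≼w⇒w<u) = <-asym (w≼u⇒u<w w≼u) (u≼w⇒w<u u≼w)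

≺-connex-< : ∀ {u w} → u < w → u ≺ w ⊎ w ≺ u
≺-connex-< {u} {w} u<w with u ≼? w
... | yes u≼w = inj₁ (u≼w , λ _ → u<w)
... | no  u⋠w = inj₂ (⋡⇒≺ u⋠w)

≺-connex : ∀ {u w} → u ≢ w → u ≺ w ⊎ w ≺ u
≺-connex {u} {w} u≢w with <-cmp u w
... | tri< u<w _ _ = ≺-connex-< u<w
... | tri≈ _ u≡w _ = ⊥-elim (u≢w u≡w)
... | tri> _ _ w<u = swap (≺-connex-< w<u)

prefix digit : ℕ → ℕ → ℕ
prefix j v = num v * 2 ^ j /2^ elt v
digit  j v = 2 * (num v * 2 ^ j %2^ elt v) /2^ elt v

prefix-suc : ∀ j v → prefix (suc j) v ≡ 2 * prefix j v + digit j v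
prefix-suc j v = trans (cong (_/2^ elt v) (x∙yz≈y∙xz (num v) 2 (2 ^ j)))
                       (double-/ (num v * 2 ^ j) (2 ^ elt v) {{m^n≢0 2 (elt v)}})

digit≤1 : ∀ j v → digit j v ≤ 1
digit≤1 j v = double-%-/≤1 (num v * 2 ^ j) (2 ^ elt v) {{m^n≢0 2 (elt v)}}

digit≢0 : ∀ j v → digit j v ≢ 0 → digit j v ≡ 1
digit≢0 j v d≢0 with digit j v | digit≤1 j v
... | zero  | _       = ⊥-elim (d≢0 refl)
... | suc _ | s≤s z≤n = refl

digit≢1 : ∀ j v → digit j v ≢ 1 → digit j v ≡ 0
digit≢1 j v d≢1 with digit j v | digit≤1 j v
... | zero  | _       = refl
... | suc _ | s≤s z≤n = ⊥-elim (d≢1 refl)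

prefix-mono : ∀ j {u w} → u ≼ w → prefix j u ≤ prefix j w
prefix-mono j {u} {w} = cross-floor-mono {num u} {num w} (2 ^ j) {{m^n≢0 2 (elt u)}} {{m^n≢0 2 (elt w)}}

digit<⇒≺ : ∀ j {u w} → prefix j u ≡ prefix j w → digit j u < digit j w → u ≺ w
digit<⇒≺ j {u} {w} same-prefix du<dw =
  ⋡⇒≺ λ w≼u → <⇒≱ longer-prefix< (prefix-mono (suc j) {w} {u} w≼u)
  where
  open ≤-Reasoning
  longer-prefix< : prefix (suc j) u < prefix (suc j) w
  longer-prefix< = begin-strict
    prefix (suc j) u           ≡⟨ prefix-suc j u ⟩
    2 * prefix j u + digit j u <⟨ +-monoʳ-< (2 * prefix j u) du<dw ⟩
    2 * prefix j u + digit j w ≡⟨ cong (λ p → 2 * p + digit j w) same-prefix ⟩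
    2 * prefix j w + digit j w ≡⟨ prefix-suc j w ⟨
    prefix (suc j) w           ∎

module _ {f : Baire} (f-char : IsChar f) {v : ℕ} (v-vertex : IsVertex f v) where
  open IsVertex v-vertex

  vertex-num< : num v < 2 ^ elt v
  vertex-num< = subst (_< 2 ^ elt v) (sym num≡typeCode) (typeCode<2^ f-char (elt v) (elt v))

  vertex-prefix : ∀ {j} → j ≤ elt v → prefix j v ≡ typeCode f (elt v) j
  vertex-prefix {j} j≤n = begin
    num v * 2 ^ j /2^ n          ≡⟨ cong (λ a → a * 2 ^ j /2^ n) num≡typeCode ⟩
    typeCode f n n * 2 ^ j /2^ n ≡⟨ subst (λ m → typeCode f n m * 2 ^ j /2^ m ≡ typeCode f n j)
                                          (m∸n+n≡m j≤n) (typeCode-prefix f-char n (n ∸ j) j) ⟩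
    typeCode f n j               ∎
    where
    open ≡-Reasoning
    n : ℕ
    n = elt v

  vertex-digit : ∀ {j} → j < elt v → digit j v ≡ f (pair j (elt v))
  vertex-digit {j} j<n = +-cancelˡ-≡ (2 * prefix j v) _ _ (begin
    2 * prefix j v + digit j v        ≡⟨ prefix-suc j v ⟨
    prefix (suc j) v                  ≡⟨ vertex-prefix j<n ⟩
    2 * typeCode f n j + f (pair j n) ≡⟨ cong (λ c → 2 * c + f (pair j n)) (vertex-prefix (<⇒≤ j<n)) ⟨
    2 * prefix j v + f (pair j n)     ∎)
    where
    open ≡-Reasoning
    n : ℕ
    n = elt v

-- Settling of digits along a set of vertices

module Eventually (S : ℕ → Set) where

  EventuallyConstant : (ℕ → ℕ) → Set
  EventuallyConstant g = ∃₂ λ c N → ∀ {v} → N ≤ v → S v → g v ≡ c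

  prefix-suc-constant : ∀ i → EventuallyConstant (prefix i) → EventuallyConstant (digit i) →
                        EventuallyConstant (prefix (suc i))
  prefix-suc-constant i (p , N₁ , prefix≡p) (d , N₂ , digit≡d) =
    2 * p + d , N₁ ⊔ N₂ , λ {v} N≤v sv → begin
      prefix (suc i) v           ≡⟨ prefix-suc i v ⟩
      2 * prefix i v + digit i v ≡⟨ cong₂ (λ a b → 2 * a + b) (prefix≡p (m⊔n≤o⇒m≤o N₁ N₂ N≤v) sv)
                                                               (digit≡d (m⊔n≤o⇒n≤o N₁ N₂ N≤v) sv) ⟩
      2 * p + d                  ∎
    where open ≡-Reasoning

  digits-constant : EventuallyConstant (prefix 0) →
                    (∀ i → EventuallyConstant (prefix i) → EventuallyConstant (digit i)) →
                    ∀ i → EventuallyConstant (digit i)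
  digits-constant prefix₀ settle i = settle i (prefixes i)
    where
    prefixes : ∀ i → EventuallyConstant (prefix i)
    prefixes zero    = prefix₀
    prefixes (suc i) = prefix-suc-constant i (prefixes i) (settle i (prefixes i))

  module _ (lem : ExcludedMiddle 0ℓ) (i : ℕ) (prefix-constant : EventuallyConstant (prefix i)) where

    private
      N : ℕ
      N = proj₁ (proj₂ prefix-constant)

      prefix≡ : ∀ {v} → N ≤ v → S v → prefix i v ≡ proj₁ prefix-constant
      prefix≡ = proj₂ (proj₂ prefix-constant)

      0-then-1⇒≺ : ∀ {u w} → N ≤ u → N ≤ w → S u → S w → digit i u ≡ 0 → digit i w ≡ 1 → u ≺ w
      0-then-1⇒≺ N≤u N≤w su sw du≡0 dw≡1 =
        digit<⇒≺ i (trans (prefix≡ N≤u su) (sym (prefix≡ N≤w sw))) (subst₂ _<_ (sym du≡0) (sym dw≡1) ≤-refl)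

    digit-settles-increasing : ∀ {N₀} → (∀ {u w} → N₀ ≤ u → u < w → S u → S w → u ≺ w) →
                               EventuallyConstant (digit i)
    digit-settles-increasing {N₀} increasing with lem {∃ λ u → N ⊔ N₀ ≤ u × S u × digit i u ≡ 1}
    ... | yes (u , M≤u , su , du≡1) = 1 , suc u , λ {w} u<w sw → digit≢0 i w λ dw≡0 →
          ≺-asym (increasing (m⊔n≤o⇒n≤o N N₀ M≤u) u<w su sw)
                 (0-then-1⇒≺ (≤-trans N≤u (<⇒≤ u<w)) N≤u sw su dw≡0 du≡1)
      where
      N≤u : N ≤ u
      N≤u = m⊔n≤o⇒m≤o N N₀ M≤u
    ... | no no-one = 0 , N ⊔ N₀ , λ {w} M≤w sw → digit≢1 i w λ dw≡1 → no-one (w , M≤w , sw , dw≡1)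

    digit-settles-sparse : (∀ {u₁ u₂ w} → u₁ < u₂ → u₂ < w → S u₁ → S u₂ → S w → u₁ ≺ w → u₂ ≺ w → ⊥) →
                           EventuallyConstant (digit i)
    digit-settles-sparse no-two-lower
      with lem {∃₂ λ u₁ u₂ → N ≤ u₁ × u₁ < u₂ × S u₁ × S u₂ × digit i u₁ ≡ 0 × digit i u₂ ≡ 0}
    ... | yes (u₁ , u₂ , N≤u₁ , u₁<u₂ , s₁ , s₂ , d₁≡0 , d₂≡0) =
          0 , suc u₂ , λ {w} u₂<w sw → digit≢1 i w λ dw≡1 →
          no-two-lower u₁<u₂ u₂<w s₁ s₂ sw (0-then-1⇒≺ N≤u₁ (N≤ u₂<w) s₁ sw d₁≡0 dw≡1)
                                           (0-then-1⇒≺ N≤u₂ (N≤ u₂<w) s₂ sw d₂≡0 dw≡1)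
      where
      N≤u₂ : N ≤ u₂
      N≤u₂ = ≤-trans N≤u₁ (<⇒≤ u₁<u₂)
      N≤ : ∀ {w} → u₂ < w → N ≤ w
      N≤ u₂<w = ≤-trans N≤u₂ (<⇒≤ u₂<w)
    ... | no no-two-zeros with lem {∃ λ u → N ≤ u × S u × digit i u ≡ 0}
    ...   | yes (u , N≤u , su , du≡0) = 1 , suc u , λ {w} u<w sw → digit≢0 i w λ dw≡0 →
            no-two-zeros (u , w , N≤u , u<w , su , sw , du≡0 , dw≡0)
    ...   | no no-zero = 1 , N , λ {w} N≤w sw → digit≢0 i w λ dw≡0 → no-zero (w , N≤w , sw , dw≡0)

-- The graph

Ascending : ℕ → ℕ → Set
Ascending x y = x < y × x ≺ y

CohEdge : Baire → ℕ → ℕ → Set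
CohEdge f x y = IsVertex f x × IsVertex f y × (Ascending x y ⊎ Ascending y x)

cohEdge? : ∀ f x y → Dec (CohEdge f x y)
cohEdge? f x y = isVertex? f x ×-dec isVertex? f y ×-dec (ascending? x y ⊎-dec ascending? y x)
  where
  ascending? : ∀ x y → Dec (Ascending x y)
  ascending? x y = (x <? y) ×-dec (x ≺? y)

half-step : ℕ × Bool → ℕ × Bool
half-step (k , false) = k , true
half-step (k , true)  = suc k , false

half : ℕ → ℕ × Bool
half zero    = 0 , false
half (suc m) = half-step (half m)

half-even : ∀ k → half (2 * k) ≡ (k , false)
half-even zero    = refl
half-even (suc k) = trans (cong half (*-suc 2 k)) (cong (half-step ∘ half-step) (half-even k))

half-odd : ∀ k → half (suc (2 * k)) ≡ (k , true)
half-odd k = cong half-step (half-even k)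

graphEntry : Baire → ℕ × Bool → ℕ
graphEntry f (k , false) = indicator (isVertex? f k)
graphEntry f (k , true)  = indicator (uncurry (cohEdge? f) (unpair k))

cohGraph : Baire → Baire
cohGraph f m = graphEntry f (half m)

module _ (f : Baire) where

  cohGraph-vert : ∀ v → cohGraph f (2 * v) ≡ indicator (isVertex? f v)
  cohGraph-vert v = cong (graphEntry f) (half-even v)

  cohGraph-edge : ∀ x y → cohGraph f (suc (2 * pair x y)) ≡ indicator (cohEdge? f x y)
  cohGraph-edge x y = begin
    graphEntry f (half (suc (2 * pair x y)))             ≡⟨ cong (graphEntry f) (half-odd (pair x y)) ⟩
    indicator (uncurry (cohEdge? f) (unpair (pair x y))) ≡⟨ cong (indicator ∘ uncurry (cohEdge? f))
                                                                 (unpair-pair x y) ⟩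
    indicator (cohEdge? f x y)                           ∎
    where open ≡-Reasoning

  vert⇒isVertex : ∀ {v} → Vert (cohGraph f) v → IsVertex f v
  vert⇒isVertex {v} = indicator-sound (isVertex? f v) ∘ trans (sym (cohGraph-vert v))

  isVertex⇒vert : ∀ {v} → IsVertex f v → Vert (cohGraph f) v
  isVertex⇒vert {v} = trans (cohGraph-vert v) ∘ indicator-complete (isVertex? f v)

  edge⇒cohEdge : ∀ {x y} → Edge (cohGraph f) x y → CohEdge f x y
  edge⇒cohEdge {x} {y} = indicator-sound (cohEdge? f x y) ∘ trans (sym (cohGraph-edge x y))

  cohEdge⇒edge : ∀ {x y} → CohEdge f x y → Edge (cohGraph f) x y
  cohEdge⇒edge {x} {y} = trans (cohGraph-edge x y) ∘ indicator-complete (cohEdge? f x y)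

  cohGraph-isGraph : IsGraph (cohGraph f)
  cohGraph-isGraph = entry≤1 , vertices-unbounded , symmetric , irreflexive , endpoints
    where
    entry≤1 : IsChar (cohGraph f)
    entry≤1 m with half m
    ... | k , false = indicator≤1 (isVertex? f k)
    ... | k , true  = indicator≤1 (uncurry (cohEdge? f) (unpair k))

    vertices-unbounded : Infinite (Vert (cohGraph f))
    vertices-unbounded n = pair n c , m≤pair[m,n] n c , isVertex⇒vert c-isVertex
      where
      c : ℕ
      c = typeCode f n n
      c-isVertex : IsVertex f (pair n c)
      c-isVertex = isVertex (subst (λ (m , a) → a ≡ typeCode f m m) (sym (unpair-pair n c)) refl)

    symmetric : ∀ x y → Edge (cohGraph f) x y → Edge (cohGraph f) y x
    symmetric x y e with edge⇒cohEdge {x} {y} e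
    ... | x-vertex , y-vertex , xy = cohEdge⇒edge {y} {x} (y-vertex , x-vertex , swap xy)

    irreflexive : ∀ x → ¬ Edge (cohGraph f) x x
    irreflexive x e with edge⇒cohEdge {x} {x} e
    ... | _ , _ , inj₁ (x<x , _) = <-irrefl refl x<x
    ... | _ , _ , inj₂ (x<x , _) = <-irrefl refl x<x

    endpoints : ∀ x y → Edge (cohGraph f) x y → Vert (cohGraph f) x × Vert (cohGraph f) y
    endpoints x y e with edge⇒cohEdge {x} {y} e
    ... | x-vertex , y-vertex , _ = isVertex⇒vert x-vertex , isVertex⇒vert y-vertex

-- Selecting the cohesive set from a solution

module Selection (h : Baire) where

  InH : ℕ → Set
  InH v = h v ≡ 1

  inH? : ∀ v → Dec (InH v)
  inH? v = h v ≟ 1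

  RecordFrom : ℕ → ℕ → Set
  RecordFrom q v = ∀ {u} → u < v → q ≤ u → InH u → u ≺ v

  recordFrom? : ∀ q v → Dec (RecordFrom q v)
  recordFrom? q v = allUpTo? (λ u → (q ≤? u) →-dec (inH? u →-dec (u ≺? v))) v

  Pattern : ℕ → ℕ → Set
  Pattern p q = InH p × InH q × (∃ λ u → u < p × q < u × InH u) × RecordFrom q p

  pattern? : ∀ p q → Dec (Pattern p q)
  pattern? p q =
    inH? p ×-dec inH? q ×-dec anyUpTo? (λ u → (q <? u) ×-dec inH? u) p ×-dec recordFrom? q p

  HasPattern : ℕ → Set
  HasPattern p = ∃ λ q → q < p × Pattern p q

  hasPattern? : ∀ p → Dec (HasPattern p)
  hasPattern? p = anyUpTo? (pattern? p) p

  firstPattern? : ∀ p → Dec (Least HasPattern p)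
  firstPattern? p = hasPattern? p ×-dec allUpTo? (¬? ∘ hasPattern?) p

  AtMostOneLower : ℕ → Set
  AtMostOneLower v = ∀ {u₂} → u₂ < v → InH u₂ → u₂ ≺ v → ∀ {u₁} → u₁ < u₂ → ¬ (InH u₁ × u₁ ≺ v)

  atMostOneLower? : ∀ v → Dec (AtMostOneLower v)
  atMostOneLower? v =
    allUpTo? (λ u₂ → inH? u₂ →-dec (u₂ ≺? v →-dec allUpTo? (λ u₁ → ¬? (inH? u₁ ×-dec u₁ ≺? v)) u₂)) v

  Selected : ℕ → Set
  Selected v = InH v × ((¬ (∃ λ p → p < suc v × HasPattern p) × AtMostOneLower v)
                       ⊎ (∃ λ p → p < suc v × Least HasPattern p × RecordFrom p v))

  selected? : ∀ v → Dec (Selected v)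
  selected? v = inH? v ×-dec ((¬? (anyUpTo? hasPattern? (suc v)) ×-dec atMostOneLower? v)
                             ⊎-dec anyUpTo? (λ p → firstPattern? p ×-dec recordFrom? p v) (suc v))

  -- Only h is available here, so the numerator of the vertex of n is searched for.
  Chosen : ℕ → Set
  Chosen n = ∃ λ a → a < 2 ^ n × Selected (pair n a)

  chosen? : ∀ n → Dec (Chosen n)
  chosen? n = anyUpTo? (λ a → selected? (pair n a)) (2 ^ n)

cohSolution : Baire → Baire
cohSolution h n = indicator (Selection.chosen? h n)

module Verification (lem : ExcludedMiddle 0ℓ) {f : Baire} (f-char : IsChar f)
                    {h : Baire} (h-solves : Sol wRSg (cohGraph f) h) where
  open Selection h

  H-infinite : Infinite InH
  H-infinite = proj₁ (proj₂ (proj₂ h-solves))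

  H-neighbours : ∀ v → InH v → Infinite (λ y → InH y × Edge (cohGraph f) v y)
                             ⊎ AtMostOne (λ y → InH y × Edge (cohGraph f) v y)
  H-neighbours = proj₂ (proj₂ (proj₂ h-solves))

  inH⇒vertex : ∀ {v} → InH v → IsVertex f v
  inH⇒vertex {v} v∈H = vert⇒isVertex f (proj₁ (proj₂ h-solves) v v∈H)

  Higher : ℕ → ℕ → Set
  Higher v y = v < y × InH y × v ≺ y

  higher? : ∀ v y → Dec (Higher v y)
  higher? v y = (v <? y) ×-dec inH? y ×-dec (v ≺? y)

  twoLower⇒higher : ∀ {v u₁ u₂} → InH v → u₁ < u₂ → u₂ < v → InH u₁ → InH u₂ → u₁ ≺ v → u₂ ≺ v →
                    ∃ (Higher v)
  twoLower⇒higher {v} {u₁} {u₂} v∈H u₁<u₂ u₂<v u₁∈H u₂∈H u₁≺v u₂≺v with H-neighbours v v∈H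
  ... | inj₂ at-most-one =
        ⊥-elim (<⇒≢ u₁<u₂ (at-most-one u₁ u₂ (u₁∈H , lower-edge (<-trans u₁<u₂ u₂<v) u₁∈H u₁≺v)
                                             (u₂∈H , lower-edge u₂<v u₂∈H u₂≺v)))
    where
    lower-edge : ∀ {u} → u < v → InH u → u ≺ v → Edge (cohGraph f) v u
    lower-edge u<v u∈H u≺v = cohEdge⇒edge f (inH⇒vertex v∈H , inH⇒vertex u∈H , inj₂ (u<v , u≺v))
  ... | inj₁ infinitely-many with infinitely-many (suc v)
  ...   | y , v<y , y∈H , e with edge⇒cohEdge f {v} {y} e
  ...     | _ , _ , inj₁ (_ , v≺y) = y , v<y , y∈H , v≺y
  ...     | _ , _ , inj₂ (y<v , _) = ⊥-elim (<-asym v<y y<v)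

  NextHigher : ℕ → ℕ → Set
  NextHigher v r = Higher v r × (∀ {u} → v < u → u < r → InH u → u ≺ v)

  nextHigher : ∀ {v} → ∃ (Higher v) → ∃ (NextHigher v)
  nextHigher {v} (y , v<y) with minimal (higher? v) y v<y
  ... | r , r-higher , none-before = r , r-higher , below
    where
    below : ∀ {u} → v < u → u < r → InH u → u ≺ v
    below {u} v<u u<r u∈H with ≺-connex (<⇒≢ v<u)
    ... | inj₁ v≺u = ⊥-elim (none-before u<r (v<u , u∈H , v≺u))
    ... | inj₂ u≺v = u≺v

  record-extends : ∀ {q v r} → RecordFrom q v → NextHigher v r → RecordFrom q r
  record-extends {v = v} v-record ((_ , _ , v≺r) , below) {u} u<r q≤u u∈H with <-cmp u v
  ... | tri< u<v _ _  = ≺-trans (v-record u<v q≤u u∈H) v≺r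
  ... | tri≈ _ refl _ = v≺r
  ... | tri> _ _ v<u  = ≺-trans (below v<u u<r u∈H) v≺r

  climbing⇒pattern : ∀ {a} → InH a → (∀ {v} → a ≤ v → InH v → ∃ (Higher v)) → ∃ HasPattern
  climbing⇒pattern {a} a∈H climbing with nextHigher (climbing ≤-refl a∈H)
  ... | r₁ , next₁@((a<r₁ , r₁∈H , _) , _) with nextHigher (climbing (<⇒≤ a<r₁) r₁∈H)
  ...   | r₂ , next₂@((r₁<r₂ , r₂∈H , _) , _) =
          r₂ , a , <-trans a<r₁ r₁<r₂ , r₂∈H , a∈H , (r₁ , r₁<r₂ , a<r₁ , r₁∈H) ,
          record-extends (record-extends (λ u<a a≤u _ → ⊥-elim (<⇒≱ u<a a≤u)) next₁) next₂

  open Eventually Selected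

  selected⇒vertex : ∀ {v} → Selected v → IsVertex f v
  selected⇒vertex = inH⇒vertex ∘ proj₁

  selected⇒chosen : ∀ {v} → Selected v → Chosen (elt v)
  selected⇒chosen {v} sv =
    num v , vertex-num< f-char (selected⇒vertex sv) , subst Selected (sym (pair-unpair v)) sv

  chosen-infinite : Infinite Selected → Infinite (λ n → cohSolution h n ≡ 1)
  chosen-infinite selected-infinite N = from-selected (selected-infinite (suc (pair N (2 ^ N))))
    where
    from-selected : (∃ λ v → suc (pair N (2 ^ N)) ≤ v × Selected v) → ∃ λ n → N ≤ n × cohSolution h n ≡ 1
    from-selected (v , bound<v , sv) =
      elt v , N≤elt , indicator-complete (chosen? (elt v)) (selected⇒chosen sv)
      where
      N≤elt : N ≤ elt v
      N≤elt = ≮⇒≥ λ elt<N → <⇒≱ bound<v (begin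
        v                    ≡⟨ pair-unpair v ⟨
        pair (elt v) (num v) ≤⟨ pair-mono-≤ (<⇒≤ elt<N)
                                 (<⇒≤ (<-≤-trans (vertex-num< f-char (selected⇒vertex sv))
                                                 (^-monoʳ-≤ 2 (<⇒≤ elt<N)))) ⟩
        pair N (2 ^ N)       ∎)
        where open ≤-Reasoning

  membership-settles : ∀ i {c N} → (∀ {v} → N ≤ v → Selected v → digit i v ≡ c) →
                       ∀ {n} → Chosen n → N ⊔ suc i ≤ n → f (pair i n) ≡ c
  membership-settles i {c} {N} digit≡c {n} (a , _ , sv) B≤n =
    subst (λ m → f (pair i m) ≡ c) elt≡n (begin
      f (pair i (elt v)) ≡⟨ vertex-digit f-char (selected⇒vertex sv) i<elt ⟨
      digit i v          ≡⟨ digit≡c (≤-trans (m⊔n≤o⇒m≤o N (suc i) B≤n) (m≤pair[m,n] n a)) sv ⟩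
      c                  ∎)
    where
    open ≡-Reasoning
    v : ℕ
    v = pair n a
    elt≡n : elt v ≡ n
    elt≡n = cong proj₁ (unpair-pair n a)
    i<elt : i < elt v
    i<elt = subst (i <_) (sym elt≡n) (m⊔n≤o⇒n≤o N (suc i) B≤n)

  cohesive-if-settled : ∀ i {c B} → (∀ {n} → Chosen n → B ≤ n → f (pair i n) ≡ c) → Dec (c ≡ 1) →
                        Finite (λ n → cohSolution h n ≡ 1 × ¬ f (pair i n) ≡ 1)
                        ⊎ Finite (λ n → cohSolution h n ≡ 1 × f (pair i n) ≡ 1)
  cohesive-if-settled _ {B = B} member≡c (yes c≡1) =
    inj₁ (B , λ n (cn , n∉Aᵢ) → ≰⇒> λ B≤n →
      n∉Aᵢ (trans (member≡c (indicator-sound (chosen? n) cn) B≤n) c≡1))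
  cohesive-if-settled _ {B = B} member≡c (no c≢1) =
    inj₂ (B , λ n (cn , n∈Aᵢ) → ≰⇒> λ B≤n →
      c≢1 (trans (sym (member≡c (indicator-sound (chosen? n) cn) B≤n)) n∈Aᵢ))

  cohSolution-solves-if : Infinite Selected →
                          (∀ i → EventuallyConstant (prefix i) → EventuallyConstant (digit i)) →
                          Sol COH f (cohSolution h)
  cohSolution-solves-if selected-infinite settle =
    (λ n → indicator≤1 (chosen? n)) , chosen-infinite selected-infinite ,
    λ i → let (c , _ , digit≡c) = digits-constant prefix₀-constant settle i
          in cohesive-if-settled i (membership-settles i digit≡c) (c ≟ 1)
    where
    prefix₀-constant : EventuallyConstant (prefix 0)
    prefix₀-constant = 0 , 0 , λ _ sv → vertex-prefix f-char (selected⇒vertex sv) z≤n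

  module NoPattern (no-pattern : ∀ p → ¬ HasPattern p) where

    selected⇒atMostOneLower : ∀ {v} → Selected v → AtMostOneLower v
    selected⇒atMostOneLower (_ , inj₁ (_ , at-most-one))            = at-most-one
    selected⇒atMostOneLower (_ , inj₂ (p , _ , (p-pattern , _) , _)) = ⊥-elim (no-pattern p p-pattern)

    no-two-lower : ∀ {u₁ u₂ w} → u₁ < u₂ → u₂ < w → Selected u₁ → Selected u₂ → Selected w →
                   u₁ ≺ w → u₂ ≺ w → ⊥
    no-two-lower u₁<u₂ u₂<w s₁ s₂ sw u₁≺w u₂≺w =
      selected⇒atMostOneLower sw u₂<w (proj₁ s₂) u₂≺w u₁<u₂ (proj₁ s₁ , u₁≺w)

    Maximal : ℕ → Set
    Maximal v = InH v × ∀ {y} → ¬ Higher v y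

    maximal⇒selected : ∀ {v} → Maximal v → Selected v
    maximal⇒selected (v∈H , no-higher) =
      v∈H , inj₁ ((λ (p , _ , p-pattern) → no-pattern p p-pattern) ,
                  λ u₂<v u₂∈H u₂≺v u₁<u₂ (u₁∈H , u₁≺v) →
                    no-higher (proj₂ (twoLower⇒higher v∈H u₁<u₂ u₂<v u₁∈H u₂∈H u₁≺v u₂≺v)))

    selected-infinite : Infinite Selected
    selected-infinite N with lem {∃ λ v → N ≤ v × Maximal v}
    ... | yes (v , N≤v , v-maximal) = v , N≤v , maximal⇒selected v-maximal
    ... | no none with H-infinite N
    ...   | a , N≤a , a∈H = ⊥-elim (no-pattern _ (proj₂ (climbing⇒pattern a∈H higher-exists)))
      where
      higher-exists : ∀ {v} → a ≤ v → InH v → ∃ (Higher v)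
      higher-exists {v} a≤v v∈H with lem {∃ (Higher v)}
      ... | yes found    = found
      ... | no no-higher = ⊥-elim (none (v , ≤-trans N≤a a≤v , v∈H , λ higher → no-higher (_ , higher)))

  module FirstPatternAt {p} (first : Least HasPattern p) where

    q : ℕ
    q = proj₁ (proj₁ first)

    q<p : q < p
    q<p = proj₁ (proj₂ (proj₁ first))

    p-pattern : Pattern p q
    p-pattern = proj₂ (proj₂ (proj₁ first))

    record-next : ∀ {v} → p ≤ v → InH v → RecordFrom q v → ∃ λ r → v < r × InH r × RecordFrom q r
    record-next {v} p≤v v∈H v-record with p-pattern
    ... | _ , q∈H , (u , u<p , q<u , u∈H) , _ =
          extend (nextHigher (twoLower⇒higher v∈H q<u u<v q∈H u∈H
                                (v-record (<-trans q<u u<v) ≤-refl q∈H) (v-record u<v (<⇒≤ q<u) u∈H)))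
      where
      u<v : u < v
      u<v = <-≤-trans u<p p≤v
      extend : ∃ (NextHigher v) → ∃ λ r → v < r × InH r × RecordFrom q r
      extend (r , next@((v<r , r∈H , _) , _)) = r , v<r , r∈H , record-extends v-record next

    records-unbounded : ∀ N → ∃ λ v → N ≤ v × p ≤ v × InH v × RecordFrom q v
    records-unbounded zero = p , z≤n , ≤-refl , proj₁ p-pattern , proj₂ (proj₂ (proj₂ p-pattern))
    records-unbounded (suc N) with records-unbounded N
    ... | v , N≤v , p≤v , v∈H , v-record with record-next p≤v v∈H v-record
    ...   | r , v<r , r∈H , r-record = r , ≤-<-trans N≤v v<r , ≤-trans p≤v (<⇒≤ v<r) , r∈H , r-record

    selected-infinite : Infinite Selected
    selected-infinite N with records-unbounded N
    ... | v , N≤v , p≤v , v∈H , v-record =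
          v , N≤v , v∈H , inj₂ (p , s≤s p≤v , first , λ u<v p≤u → v-record u<v (≤-trans (<⇒≤ q<p) p≤u))

    selected⇒record : ∀ {v} → p ≤ v → Selected v → RecordFrom p v
    selected⇒record p≤v (_ , inj₁ (no-pattern-yet , _)) = ⊥-elim (no-pattern-yet (p , s≤s p≤v , proj₁ first))
    selected⇒record {v} p≤v (_ , inj₂ (p′ , _ , first′ , p′-record)) =
      subst (λ x → RecordFrom x v) (Least-unique first′ first) p′-record

    increasing : ∀ {u w} → p ≤ u → u < w → Selected u → Selected w → u ≺ w
    increasing p≤u u<w su sw = selected⇒record (≤-trans p≤u (<⇒≤ u<w)) sw u<w p≤u (proj₁ su)

  cohSolution-solves : Sol COH f (cohSolution h)
  cohSolution-solves = by-cases (lem {∃ HasPattern})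
    where
    by-cases : Dec (∃ HasPattern) → Sol COH f (cohSolution h)
    by-cases (no none) =
      cohSolution-solves-if selected-infinite (λ i c → digit-settles-sparse lem i c no-two-lower)
      where open NoPattern (λ p p-pattern → none (p , p-pattern))
    by-cases (yes (p , p-pattern)) =
      cohSolution-solves-if selected-infinite (λ i c → digit-settles-increasing lem i c increasing)
      where open FirstPatternAt (proj₂ (minimal hasPattern? p p-pattern))

immediately : (Baire → Baire) → Functional
immediately g x n _ = just (g x n)

immediately-computes : ∀ g x → immediately g ⟦ x ⟧≡ g x
immediately-computes g x n = 0 , refl , λ _ ()

theorem6p9 : COH ≤sW wRSg
theorem6p9 = immediately cohGraph , immediately cohSolution , λ lem f f-char →
  cohGraph f , immediately-computes cohGraph f , cohGraph-isGraph f , λ h h-solves →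
  cohSolution h , immediately-computes cohSolution h ,
  Verification.cohSolution-solves lem {f} f-char {h} h-solves
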